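{- Let $F$ be a plane forest on $n+1$ nodes with components (plane trees) $T_1,\dots,T_m$ from left to right. For a plane tree $T$ on $a$ nodes let $\mathbf{D}_T\subset\mathbb{R}^{a-1}$ be defined (using the NFS positions $p(u)\in\{0,\dots,a-1\}$ of the nodes of $T$ alone and $x_0:=1$) by the inequalities $1\le x_{p(u_1)}/2^{j(u_1)}\le\dots\le x_{p(u_k)}/2^{j(u_k)}\le 2$ for every node with children $u_1,\dots,u_k$ (left to right), where $j(u)$ is the number of cane paths of $T$ starting at $u$. Define $\mathbf{D}_F=\mathbf{D}_{T_1}\times\operatorname{cone}(\mathbf{D}_{T_2}\times\operatorname{cone}(\mathbf{D}_{T_3}\times\cdots\operatorname{cone}(\mathbf{D}_{T_m})\cdots))\subset\mathbb{R}^n$ (and $\mathbf{D}_F=\mathbf{D}_{T_1}$ if $m=1$). Now, using NFS positions in $F$, define for a root $w$ of position $l$: $c(w,F)=x_l$ (with $x_0:=1$), and for a non-root node $v$ of position $i$ whose component's root has position $l$: $c(v,F)=x_i/2^{j}-x_l$, where $j$ is the number of cane paths of $F$ starting at $v$. Consider the polytope in $\mathbb{R}^n$ (variables $x_1,\dots,x_n$) defined by: for every node with children $v_1,\dots,v_k$ (left to right), $0\le c(v_1,F)\le\dots\le c(v_k,F)\le c(w,F)$, where $w$ is the root of the component of that node; and, if $w_1,\dots,w_m$ are the roots from left to right, $0\le c(w_m,F)\le\dots\le c(w_1,F)=1$. This polytope is precisely $\mathbf{D}_F$.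
   Context: A plane tree is an unlabeled rooted tree with the children of each node ordered left to right; a plane forest is a left-to-right sequence of plane trees. NFS positions in a forest on $N$ nodes: each node gets a position in $\{0,\dots,N-1\}$. Components are processed from left to right; when a component is begun its root gets the next unused position (so each root gets the number of nodes in components to its left). Within a component the root is initially active; the children of the active node receive the next consecutive positions from right to left, then the leftmost of these children becomes active; if the active node has no children, the most recently positioned node not yet active becomes active. Cane path: a path $v_0,\dots,v_k$ ($k\ge 2$) such that each of the first $k-1$ steps goes from a node to its parent and the last step goes from $v_{k-1}$ to a child of $v_{k-1}$ lying to the right of $v_{k-2}$. For $\mathbf{P}\subset\mathbb{R}^d$, $\operatorname{cone}(\mathbf{P})=\{(x_0,x_1,\dots,x_d): 0\le x_0\le 1,\ (x_1,\dots,x_d)\in x_0\mathbf{P}\}\subset\mathbb{R}^{d+1}$, where $a\mathbf{P}=\{ay:y\in\mathbf{P}\}$; for $d=0$ this is $[0,1]$. In the iterated product the coordinates are concatenated in order, so the coordinates of $\mathbb{R}^n$ correspond to the NFS positions $1,\dots,n$ in $F$.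
   Formalization: The two polytopes are compared only at points with rational coordinates, rather than at all points of ℝ^n. -}

module Defs where

open import Data.Nat using (ℕ; zero; suc; _∸_) renaming (_+_ to _+ℕ_)
open import Data.List using (List; []; _∷_; _++_; length; map; reverse; [_])
open import Data.List.Relation.Unary.Linked using (Linked)
open import Data.Rational using (ℚ; 0ℚ; 1ℚ; ½; _+_; _*_; _-_; _≤_)
open import Data.Product using (Σ; _×_; ∃)
open import Data.Empty using (⊥)
open import Data.Unit using (⊤)
open import Relation.Binary.PropositionalEquality using (_≡_)

data Tree : Set where
  node : List Tree → Tree     -- children ordered left to right

Forest : Set
Forest = List Tree            -- components ordered left to right

mutual
  size : Tree → ℕ
  size (node ts) = suc (sizes ts)

  sizes : List Tree → ℕ
  sizes []       = 0
  sizes (t ∷ ts) = size t +ℕ sizes ts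

forestSize : Forest → ℕ
forestSize = sizes

-- Trees decorated with (NFS position, number of cane paths starting here)

data LTree : Set where
  lnode : (pos : ℕ) (cane : ℕ) → List LTree → LTree

-- lab t p j c : t with its root at NFS position p and cane count j,
--   and c the next unused NFS position when the root becomes active.
-- A node with children c₁..c_k becoming active when the counter is c
-- gives c_i the position c + (k - i) (right to left); afterwards the
-- subtrees of c₁, c₂, …, c_k are processed in this order (LIFO stack),
-- the descendants of c₁ starting at counter c + k, etc.
-- Cane paths from c_i: one for each child of an ancestor a lying to the
-- right of the child of a on the way to c_i; so j(c_i) = j(parent) + (k - i).
mutual
  lab : Tree → (pos cane next : ℕ) → LTree
  lab (node ts) p j c = lnode p j (labs ts c j (c +ℕ length ts))

  labs : List Tree → (base cane next : ℕ) → List LTree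
  labs []       c j nx = []
  labs (t ∷ ts) c j nx =
    lab t (c +ℕ length ts) (j +ℕ length ts) nx
      ∷ labs ts c j (nx +ℕ (size t ∸ 1))

labelTree : Tree → LTree
labelTree t = lab t 0 0 1

-- NFS labelling of a forest: each root gets the number of nodes of the
-- components to its left.  (Cane paths never leave a component.)
labelsF : Forest → ℕ → List LTree
labelsF []       c = []
labelsF (t ∷ ts) c = lab t c 0 (suc c) ∷ labelsF ts (c +ℕ size t)

labelForest : Forest → List LTree
labelForest F = labelsF F 0

posOf : LTree → ℕ
posOf (lnode p _ _) = p

mutual
  Every : (ℕ → ℕ → List LTree → Set) → LTree → Set
  Every P (lnode p j ks) = P p j ks × EveryL P ks

  EveryL : (ℕ → ℕ → List LTree → Set) → List LTree → Set
  EveryL P []       = ⊤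
  EveryL P (k ∷ ks) = Every P k × EveryL P ks

half^ : ℕ → ℚ
half^ zero    = 1ℚ
half^ (suc j) = ½ * half^ j

-- j-th element of a list (default 0ℚ; never used out of range)
nth : List ℚ → ℕ → ℚ
nth []       _       = 0ℚ
nth (y ∷ ys) zero    = y
nth (y ∷ ys) (suc i) = nth ys i

-- coordinates x₁..x_d given as a list; x₀ := 1
coord : List ℚ → ℕ → ℚ
coord ys zero    = 1ℚ
coord ys (suc i) = nth ys i

Chain : List ℚ → Set
Chain = Linked _≤_

scaled : (ℕ → ℚ) → LTree → ℚ
scaled x (lnode p j _) = x p * half^ j

DTcond : (ℕ → ℚ) → ℕ → ℕ → List LTree → Set
DTcond x _ _ ks = Chain (1ℚ ∷ (map (scaled x) ks ++ [ 1ℚ + 1ℚ ]))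

InDT : Tree → List ℚ → Set
InDT T ys = (length ys ≡ size T ∸ 1) × Every (DTcond (coord ys)) (labelTree T)

InCone : (List ℚ → Set) → List ℚ → Set
InCone P []        = ⊥
InCone P (x₀ ∷ zs) = (0ℚ ≤ x₀) × (x₀ ≤ 1ℚ) ×
                     (Σ (List ℚ) λ y → P y × (zs ≡ map (x₀ *_) y))

InDF : Forest → List ℚ → Set
InDF []            ys = ⊥
InDF (T ∷ [])      ys = InDT T ys
InDF (T ∷ T' ∷ ts) ys =
  Σ (List ℚ) λ ys₁ → Σ (List ℚ) λ ys₂ →
    (ys ≡ ys₁ ++ ys₂) × InDT T ys₁ × InCone (InDF (T' ∷ ts)) ys₂

cNonRoot : (ℕ → ℚ) → ℕ → LTree → ℚ
cNonRoot x l (lnode i j _) = x i * half^ j - x l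

PolyCond : (ℕ → ℚ) → ℕ → ℕ → ℕ → List LTree → Set
PolyCond x l _ _ ks = Chain (0ℚ ∷ (map (cNonRoot x l) ks ++ [ x l ]))

PolyComponents : (ℕ → ℚ) → List LTree → Set
PolyComponents x []       = ⊤
PolyComponents x (r ∷ rs) = Every (PolyCond x (posOf r)) r × PolyComponents x rs

RootCond : (ℕ → ℚ) → List LTree → Set
RootCond x rs = Chain (0ℚ ∷ reverse (map (λ r → x (posOf r)) rs))
              × (x 0 ≡ 1ℚ)

InPoly : Forest → List ℚ → Set
InPoly F ys = PolyComponents (coord ys) (labelForest F)
            × RootCond (coord ys) (labelForest F)

{-# OPTIONS --safe #-}
-- Inside a component whose root has value x_l = s, write x_i = s·y_i.  Each defining chain
-- 0 ≤ c(v₁) ≤ … ≤ c(v_k) ≤ x_l is then the image of the chain 1 ≤ y/2^j ≤ … ≤ 2 of D_T under the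
-- map z ↦ s z − s, which is increasing (strictly if s > 0); so the component's conditions say y ∈ D_T.
-- The value of the next root is s·x₀ with 0 ≤ x₀ ≤ 1 by the root chain, which is exactly the cone
-- coordinate, and it is the scale of the next component: induction over the components gives D_F.
-- If x₀ = 0, the chains force every later coordinate to vanish, matching x₀·D = {0} as D ≠ ∅.
module Submission where

open import Defs
open import Data.Nat using (ℕ; zero; suc; _∸_; z≤n; s≤s)
  renaming (_+_ to _+ℕ_; _≤_ to _≤ℕ_; _<_ to _<ℕ_)
import Data.Nat.Properties as ℕ
open import Data.Vec using (Vec; toList)
import Data.Vec.Properties as Vec
open import Data.Rational
  using (ℚ; 0ℚ; 1ℚ; ½; _+_; _*_; _-_; -_; 1/_; _≤_; _<_; _≥_; NonZero; positive; nonNegative)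
import Data.Rational.Properties as ℚ
open import Data.Rational.Solver using (module +-*-Solver)
open import Data.List using (List; []; _∷_; _++_; length; map; reverse; reverseAcc; [_])
import Data.List.Properties as List
open import Data.List.Relation.Unary.All as All using (All; []; _∷_)
import Data.List.Relation.Unary.All.Properties as AllP
open import Data.List.Relation.Unary.Linked as Linked using (Linked; []; [-]; _∷_)
import Data.List.Relation.Unary.Linked.Properties as Linkedₚ
open import Data.Product using (Σ; _×_; _,_; proj₁; proj₂)
open import Data.Sum using (_⊎_; inj₁; inj₂)
open import Function using (_∘_; flip)
open import Function.Bundles using (_⇔_; mk⇔; Equivalence)
open import Level using (Level)
open import Relation.Binary.Core using (Rel)
open import Relation.Binary.Definitions using (Transitive; Tri; tri<; tri≈; tri>)
open import Relation.Binary.PropositionalEquality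
  using (_≡_; refl; sym; trans; cong; cong₂; subst; subst₂; module ≡-Reasoning)
open import Relation.Nullary using (contradiction)

open +-*-Solver

two^ : ℕ → ℚ
two^ zero    = 1ℚ
two^ (suc j) = (1ℚ + 1ℚ) * two^ j

two^*half^≡1 : ∀ j → two^ j * half^ j ≡ 1ℚ
two^*half^≡1 zero    = refl
two^*half^≡1 (suc j) = begin
  ((1ℚ + 1ℚ) * two^ j) * (½ * half^ j)  ≡⟨ interchange (two^ j) (half^ j) ⟩
  ((1ℚ + 1ℚ) * ½) * (two^ j * half^ j)  ≡⟨ cong ((1ℚ + 1ℚ) * ½ *_) (two^*half^≡1 j) ⟩
  ((1ℚ + 1ℚ) * ½) * 1ℚ                  ≡⟨⟩
  1ℚ                                    ∎
  where
  open ≡-Reasoning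
  interchange : ∀ a b → ((1ℚ + 1ℚ) * a) * (½ * b) ≡ ((1ℚ + 1ℚ) * ½) * (a * b)
  interchange = solve 2
    (λ a b → (con (1ℚ + 1ℚ) :* a) :* (con ½ :* b) := (con (1ℚ + 1ℚ) :* con ½) :* (a :* b)) refl

0<1 : 0ℚ < 1ℚ
0<1 = ℚ.positive⁻¹ 1ℚ

*-pos : ∀ {p q} → 0ℚ < p → 0ℚ < q → 0ℚ < p * q
*-pos {p} {q} 0<p 0<q = ℚ.positive⁻¹ (p * q) {{ℚ.pos*pos⇒pos p {{positive 0<p}} q {{positive 0<q}}}}

*-nonNeg : ∀ {p q} → 0ℚ ≤ p → 0ℚ ≤ q → 0ℚ ≤ p * q
*-nonNeg {p} {q} 0≤p 0≤q =
  ℚ.nonNegative⁻¹ (p * q) {{ℚ.nonNeg*nonNeg⇒nonNeg p {{nonNegative 0≤p}} q {{nonNegative 0≤q}}}}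

half^-pos : ∀ j → 0ℚ < half^ j
half^-pos zero    = 0<1
half^-pos (suc j) = *-pos (ℚ.positive⁻¹ ½) (half^-pos j)

*-cancelˡ-≡-pos : ∀ {s} → 0ℚ < s → ∀ {a b} → s * a ≡ s * b → a ≡ b
*-cancelˡ-≡-pos {s} 0<s sa≡sb =
  ℚ.≤-antisym (cancel (ℚ.≤-reflexive sa≡sb)) (cancel (ℚ.≤-reflexive (sym sa≡sb)))
  where
  cancel : ∀ {a b} → s * a ≤ s * b → a ≤ b
  cancel = ℚ.*-cancelˡ-≤-pos s {{positive 0<s}}

[p-q]+q≡p : ∀ p q → (p - q) + q ≡ p
[p-q]+q≡p = solve 2 (λ p q → (p :- q) :+ q := p) refl

≥-trans : Transitive _≥_
≥-trans = flip ℚ.≤-trans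

squeeze-0 : ∀ {a b} → b ≡ 0ℚ → 0ℚ ≤ a → a ≤ b → a ≡ 0ℚ
squeeze-0 refl 0≤a a≤0 = ℚ.≤-antisym a≤0 0≤a

affine : ℚ → ℚ → ℚ
affine s z = s * z - s

affine-mono-≤ : ∀ {s} → 0ℚ ≤ s → ∀ {a b} → a ≤ b → affine s a ≤ affine s b
affine-mono-≤ {s} 0≤s a≤b = ℚ.+-monoˡ-≤ (- s) (ℚ.*-monoˡ-≤-nonNeg s {{nonNegative 0≤s}} a≤b)

affine-cancel-≤ : ∀ {s} → 0ℚ < s → ∀ {a b} → affine s a ≤ affine s b → a ≤ b
affine-cancel-≤ {s} 0<s {a} {b} le = ℚ.*-cancelˡ-≤-pos s {{positive 0<s}}
  (subst₂ _≤_ ([p-q]+q≡p (s * a) s) ([p-q]+q≡p (s * b) s) (ℚ.+-monoˡ-≤ s le))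

affine-1 : ∀ s → affine s 1ℚ ≡ 0ℚ
affine-1 = solve 1 (λ s → s :* con 1ℚ :- s := con 0ℚ) refl

affine-2 : ∀ s → affine s (1ℚ + 1ℚ) ≡ s
affine-2 = solve 1 (λ s → s :* (con 1ℚ :+ con 1ℚ) :- s := s) refl

affine-scaled : ∀ s y h → (s * y) * h - s ≡ affine s (y * h)
affine-scaled = solve 3 (λ s y h → (s :* y) :* h :- s := s :* (y :* h) :- s) refl

nth-++ˡ : ∀ (ys zs : List ℚ) {i} → i <ℕ length ys → nth (ys ++ zs) i ≡ nth ys i
nth-++ˡ (y ∷ ys) zs {zero}  _         = refl
nth-++ˡ (y ∷ ys) zs {suc i} (s≤s i<l) = nth-++ˡ ys zs i<l

nth-++ʳ : ∀ (ys zs : List ℚ) {n} i → length ys ≡ n → nth (ys ++ zs) (n +ℕ i) ≡ nth zs i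
nth-++ʳ []       zs i refl = refl
nth-++ʳ (y ∷ ys) zs i refl = nth-++ʳ ys zs i refl

-- relies on nth [] i = 0ℚ = x * 0ℚ
nth-map-* : ∀ x (ys : List ℚ) i → nth (map (x *_) ys) i ≡ x * nth ys i
nth-map-* x []       i       = sym (ℚ.*-zeroʳ x)
nth-map-* x (y ∷ ys) zero    = refl
nth-map-* x (y ∷ ys) (suc i) = nth-map-* x ys i

nth-cone : ∀ x (ys : List ℚ) i → nth (x ∷ map (x *_) ys) i ≡ x * coord ys i
nth-cone x ys zero    = sym (ℚ.*-identityʳ x)
nth-cone x ys (suc i) = nth-map-* x ys i

split-at : ∀ (ys : List ℚ) a b → length ys ≡ a +ℕ suc b →
  Σ (List ℚ) λ ys₁ → Σ ℚ λ y → Σ (List ℚ) λ ys₂ →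
    (ys ≡ ys₁ ++ y ∷ ys₂) × (length ys₁ ≡ a) × (length ys₂ ≡ b)
split-at (y ∷ ys) zero    b eq = [] , y , ys , refl , refl , ℕ.suc-injective eq
split-at (y ∷ ys) (suc a) b eq with split-at ys a b (ℕ.suc-injective eq)
... | ys₁ , y′ , ys₂ , refl , eq₁ , eq₂ = y ∷ ys₁ , y′ , ys₂ , refl , cong suc eq₁ , eq₂

≡map-0* : ∀ (ys ws : List ℚ) → length ys ≡ length ws → (∀ i → i <ℕ length ys → nth ys i ≡ 0ℚ) →
  ys ≡ map (0ℚ *_) ws
≡map-0* []       []       _  _     = refl
≡map-0* (y ∷ ys) (w ∷ ws) eq zeros =
  cong₂ _∷_ (trans (zeros 0 (s≤s z≤n)) (sym (ℚ.*-zeroˡ w)))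
            (≡map-0* ys ws (ℕ.suc-injective eq) (λ i i<l → zeros (suc i) (s≤s i<l)))

≡map-*-1/ : ∀ x .{{_ : NonZero x}} (ys : List ℚ) → ys ≡ map (x *_) (map (1/ x *_) ys)
≡map-*-1/ x []       = refl
≡map-*-1/ x (y ∷ ys) = cong₂ _∷_ (sym x*[1/x*y]≡y) (≡map-*-1/ x ys)
  where
  open ≡-Reasoning
  x*[1/x*y]≡y : x * (1/ x * y) ≡ y
  x*[1/x*y]≡y = begin
    x * (1/ x * y)  ≡⟨ ℚ.*-assoc x (1/ x) y ⟨
    (x * 1/ x) * y  ≡⟨ cong (_* y) (ℚ.*-inverseʳ x) ⟩
    1ℚ * y          ≡⟨ ℚ.*-identityˡ y ⟩
    y               ∎

module _ {a ℓ : Level} {A : Set a} {R : Rel A ℓ} where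

  reverseAcc⁺ : ∀ {x xs ys} → Linked (flip R) (x ∷ xs) → Linked R (x ∷ ys) →
    Linked R (reverseAcc (x ∷ ys) xs)
  reverseAcc⁺ [-]        r = r
  reverseAcc⁺ (Ryx ∷ rs) r = reverseAcc⁺ rs (Ryx ∷ r)

  reverseAcc⁻ : ∀ x xs ys → Linked R (reverseAcc (x ∷ ys) xs) →
    Linked (flip R) (x ∷ xs) × Linked R (x ∷ ys)
  reverseAcc⁻ x []       ys r = [-] , r
  reverseAcc⁻ x (y ∷ xs) ys r with reverseAcc⁻ y xs (x ∷ ys) r
  ... | rs , (Ryx ∷ r′) = Ryx ∷ rs , r′

  reverse⁺ : ∀ {xs} → Linked (flip R) xs → Linked R (reverse xs)
  reverse⁺ {[]}    _  = []
  reverse⁺ {_ ∷ _} rs = reverseAcc⁺ rs [-]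

  reverse⁻ : ∀ xs → Linked R (reverse xs) → Linked (flip R) xs
  reverse⁻ []       _ = []
  reverse⁻ (x ∷ xs) r = proj₁ (reverseAcc⁻ x xs [] r)

  Linked-between : Transitive R → ∀ a b xs → Linked R (a ∷ xs ++ [ b ]) →
    R a b × All (λ x → R a x × R x b) xs
  Linked-between R-trans a b []       (Rab ∷ [-]) = Rab , []
  Linked-between R-trans a b (x ∷ xs) (Rax ∷ r) with Linked-between R-trans x b xs r
  ... | Rxb , between =
    R-trans Rax Rxb , (Rax , Rxb) ∷ All.map (λ (Rxy , Ryb) → R-trans Rax Rxy , Ryb) between

<-+-cases : ∀ m {n i} → i <ℕ m +ℕ n → i <ℕ m ⊎ Σ ℕ (λ i′ → i ≡ m +ℕ i′ × i′ <ℕ n)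
<-+-cases zero    {i = i}     i<n       = inj₂ (i , refl , i<n)
<-+-cases (suc m) {i = zero}  _         = inj₁ (s≤s z≤n)
<-+-cases (suc m) {i = suc i} (s≤s i<) with <-+-cases m i<
... | inj₁ i<m             = inj₁ (s≤s i<m)
... | inj₂ (i′ , eq , i′<n) = inj₂ (i′ , cong suc eq , i′<n)

NodeProp : Set₁
NodeProp = ℕ → ℕ → List LTree → Set

mutual
  translate : ℕ → LTree → LTree
  translate c (lnode p j ks) = lnode (c +ℕ p) j (translates c ks)

  translates : ℕ → List LTree → List LTree
  translates c []       = []
  translates c (k ∷ ks) = translate c k ∷ translates c ks

mutual
  lab-translate : ∀ t c p j nx → lab t (c +ℕ p) j (c +ℕ nx) ≡ translate c (lab t p j nx)
  lab-translate (node ts) c p j nx rewrite ℕ.+-assoc c nx (length ts) =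
    cong (lnode (c +ℕ p) j) (labs-translate ts c nx j (nx +ℕ length ts))

  labs-translate : ∀ ts c b j nx → labs ts (c +ℕ b) j (c +ℕ nx) ≡ translates c (labs ts b j nx)
  labs-translate []       c b j nx = refl
  labs-translate (t ∷ ts) c b j nx
    rewrite ℕ.+-assoc c b (length ts) | ℕ.+-assoc c nx (size t ∸ 1) =
    cong₂ _∷_ (lab-translate t c (b +ℕ length ts) (j +ℕ length ts) nx)
              (labs-translate ts c b j (nx +ℕ (size t ∸ 1)))

lab-component : ∀ T c → lab T c 0 (suc c) ≡ translate c (labelTree T)
lab-component T c =
  trans (cong₂ (λ p nx → lab T p 0 nx) (sym (ℕ.+-identityʳ c)) (ℕ.+-comm 1 c)) (lab-translate T c 0 0 1)

mutual
  Every-map : ∀ {P Q : NodeProp} → (∀ {p j ks} → P p j ks → Q p j ks) → ∀ t → Every P t → Every Q t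
  Every-map f (lnode p j ks) (Pt , Pks) = f Pt , EveryL-map f ks Pks

  EveryL-map : ∀ {P Q : NodeProp} → (∀ {p j ks} → P p j ks → Q p j ks) → ∀ ks → EveryL P ks → EveryL Q ks
  EveryL-map f []       _           = _
  EveryL-map f (k ∷ ks) (Pk , Pks) = Every-map f k Pk , EveryL-map f ks Pks

module _ {G P Q : NodeProp} (c : ℕ) where

  mutual
    Every-translate : (∀ {p j ks} → G p j ks → P p j ks → Q (c +ℕ p) j (translates c ks)) →
      ∀ t → Every G t → Every P t → Every Q (translate c t)
    Every-translate f (lnode p j ks) (Gt , Gks) (Pt , Pks) = f Gt Pt , EveryL-translate f ks Gks Pks

    EveryL-translate : (∀ {p j ks} → G p j ks → P p j ks → Q (c +ℕ p) j (translates c ks)) →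
      ∀ ks → EveryL G ks → EveryL P ks → EveryL Q (translates c ks)
    EveryL-translate f []       _          _          = _
    EveryL-translate f (k ∷ ks) (Gk , Gks) (Pk , Pks) =
      Every-translate f k Gk Pk , EveryL-translate f ks Gks Pks

  mutual
    Every-untranslate : (∀ {p j ks} → G p j ks → Q (c +ℕ p) j (translates c ks) → P p j ks) →
      ∀ t → Every G t → Every Q (translate c t) → Every P t
    Every-untranslate f (lnode p j ks) (Gt , Gks) (Qt , Qks) = f Gt Qt , EveryL-untranslate f ks Gks Qks

    EveryL-untranslate : (∀ {p j ks} → G p j ks → Q (c +ℕ p) j (translates c ks) → P p j ks) →
      ∀ ks → EveryL G ks → EveryL Q (translates c ks) → EveryL P ks
    EveryL-untranslate f []       _          _          = _
    EveryL-untranslate f (k ∷ ks) (Gk , Gks) (Qk , Qks) =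
      Every-untranslate f k Gk Qk , EveryL-untranslate f ks Gks Qks

nonRootCount : List Tree → ℕ
nonRootCount []       = 0
nonRootCount (t ∷ ts) = (size t ∸ 1) +ℕ nonRootCount ts

length+nonRootCount : ∀ ts → length ts +ℕ nonRootCount ts ≡ sizes ts
length+nonRootCount []             = refl
length+nonRootCount (node us ∷ ts) = cong suc (begin
  length ts +ℕ (sizes us +ℕ nonRootCount ts)  ≡⟨ ℕ.+-comm (length ts) _ ⟩
  (sizes us +ℕ nonRootCount ts) +ℕ length ts  ≡⟨ ℕ.+-assoc (sizes us) _ _ ⟩
  sizes us +ℕ (nonRootCount ts +ℕ length ts)  ≡⟨ cong (sizes us +ℕ_) (ℕ.+-comm (nonRootCount ts) _) ⟩
  sizes us +ℕ (length ts +ℕ nonRootCount ts)  ≡⟨ cong (sizes us +ℕ_) (length+nonRootCount ts) ⟩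
  sizes us +ℕ sizes ts                        ∎)
  where open ≡-Reasoning

InRange : ℕ → ℕ → LTree → Set
InRange lo hi k = lo ≤ℕ posOf k × posOf k <ℕ hi

ChildrenIn : ℕ → ℕ → NodeProp
ChildrenIn lo hi _ _ ks = All (InRange lo hi) ks

module _ {lo hi : ℕ} where

  mutual
    children-in : ∀ t p j nx → lo ≤ℕ nx → nx +ℕ (size t ∸ 1) ≤ℕ hi →
      Every (ChildrenIn lo hi) (lab t p j nx)
    children-in (node ts) p j nx lo≤nx nx+size≤hi =
      siblings-in ts nx j _ lo≤nx (ℕ.≤-trans (ℕ.+-monoʳ-≤ nx (ℕ.m≤m+n _ _)) bound)
      , subtrees-in ts nx j _ (ℕ.≤-trans lo≤nx (ℕ.m≤m+n nx _))
          (subst (_≤ℕ hi) (sym (ℕ.+-assoc nx (length ts) _)) bound)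
      where
      bound : nx +ℕ (length ts +ℕ nonRootCount ts) ≤ℕ hi
      bound = subst (λ n → nx +ℕ n ≤ℕ hi) (sym (length+nonRootCount ts)) nx+size≤hi

    siblings-in : ∀ ts b j nx → lo ≤ℕ b → b +ℕ length ts ≤ℕ hi → All (InRange lo hi) (labs ts b j nx)
    siblings-in []       b j nx _    _  = []
    siblings-in (node _ ∷ ts) b j nx lo≤b le =
      (ℕ.≤-trans lo≤b (ℕ.m≤m+n b _) , subst (_≤ℕ hi) (ℕ.+-suc b (length ts)) le)
      ∷ siblings-in ts b j _ lo≤b (ℕ.≤-trans (ℕ.+-monoʳ-≤ b (ℕ.n≤1+n _)) le)

    subtrees-in : ∀ ts b j nx → lo ≤ℕ nx → nx +ℕ nonRootCount ts ≤ℕ hi →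
      EveryL (ChildrenIn lo hi) (labs ts b j nx)
    subtrees-in []       b j nx _     _  = _
    subtrees-in (t ∷ ts) b j nx lo≤nx le =
      children-in t _ _ nx lo≤nx (ℕ.≤-trans (ℕ.+-monoʳ-≤ nx (ℕ.m≤m+n _ _)) le)
      , subtrees-in ts b j _ (ℕ.≤-trans lo≤nx (ℕ.m≤m+n nx _))
          (subst (_≤ℕ hi) (sym (ℕ.+-assoc nx _ _)) le)

ChildrenSatisfy : (ℕ → Set) → NodeProp
ChildrenSatisfy Q _ _ ks = All (Q ∘ posOf) ks

module _ {Q : ℕ → Set} where

  mutual
    cover-positions : ∀ t p j nx → Every (ChildrenSatisfy Q) (lab t p j nx) →
      ∀ i → i <ℕ size t ∸ 1 → Q (nx +ℕ i)
    cover-positions (node ts) p j nx (Qks , Qsub) i i<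
      with <-+-cases (length ts) (subst (i <ℕ_) (sym (length+nonRootCount ts)) i<)
    ... | inj₁ i<len              = siblings-cover ts nx j _ Qks i i<len
    ... | inj₂ (i′ , refl , i′<) =
      subst Q (ℕ.+-assoc nx (length ts) i′) (subtrees-cover ts nx j _ Qsub i′ i′<)

    siblings-cover : ∀ ts b j nx → All (Q ∘ posOf) (labs ts b j nx) → ∀ i → i <ℕ length ts → Q (b +ℕ i)
    siblings-cover (node _ ∷ ts) b j nx (Qt ∷ Qts) i i< with ℕ.m<1+n⇒m<n∨m≡n i<
    ... | inj₁ i<len = siblings-cover ts b j _ Qts i i<len
    ... | inj₂ refl  = Qt

    subtrees-cover : ∀ ts b j nx → EveryL (ChildrenSatisfy Q) (labs ts b j nx) →
      ∀ i → i <ℕ nonRootCount ts → Q (nx +ℕ i)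
    subtrees-cover (t ∷ ts) b j nx (Qt , Qts) i i< with <-+-cases (size t ∸ 1) i<
    ... | inj₁ i<t                = cover-positions t _ _ nx Qt i i<t
    ... | inj₂ (i′ , refl , i′<) = subst Q (ℕ.+-assoc nx _ i′) (subtrees-cover ts b j _ Qts i′ i′<)

module _ (X Y : ℕ → ℚ) (c : ℕ) (s : ℚ) where

  ScaledAt : LTree → Set
  ScaledAt k = X (c +ℕ posOf k) ≡ s * Y (posOf k)

  ChildrenScaled : NodeProp
  ChildrenScaled _ _ ks = All ScaledAt ks

  module _ (root : X c ≡ s) where

    PolyChain≡affine-DTChain : ∀ ks → All ScaledAt ks →
      0ℚ ∷ map (cNonRoot X c) (translates c ks) ++ [ X c ]
        ≡ map (affine s) (1ℚ ∷ map (scaled Y) ks ++ [ 1ℚ + 1ℚ ])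
    PolyChain≡affine-DTChain ks scaledAt = cong₂ _∷_ (sym (affine-1 s)) (children ks scaledAt)
      where
      children : ∀ ks → All ScaledAt ks →
        map (cNonRoot X c) (translates c ks) ++ [ X c ] ≡ map (affine s) (map (scaled Y) ks ++ [ 1ℚ + 1ℚ ])
      children []                 []             = cong [_] (trans root (sym (affine-2 s)))
      children (lnode i j _ ∷ ks) (x≡sy ∷ rest) = cong₂ _∷_
        (trans (cong₂ (λ a b → a * half^ j - b) x≡sy root) (affine-scaled s (Y i) (half^ j)))
        (children ks rest)

    DT⇒Poly-node : 0ℚ ≤ s → ∀ {p j ks} → All ScaledAt ks →
      DTcond Y p j ks → PolyCond X c (c +ℕ p) j (translates c ks)
    DT⇒Poly-node 0≤s {ks = ks} scaledAt dt =
      subst Chain (sym (PolyChain≡affine-DTChain ks scaledAt))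
        (Linkedₚ.map⁺ (Linked.map (affine-mono-≤ 0≤s) dt))

    Poly⇒DT-node : 0ℚ < s → ∀ {p j ks} → All ScaledAt ks →
      PolyCond X c (c +ℕ p) j (translates c ks) → DTcond Y p j ks
    Poly⇒DT-node 0<s {ks = ks} scaledAt pc =
      Linked.map (affine-cancel-≤ 0<s) (Linkedₚ.map⁻ (subst Chain (PolyChain≡affine-DTChain ks scaledAt) pc))

record ScaledWindow (X : ℕ → ℚ) (c N : ℕ) (s : ℚ) (Y : ℕ → ℚ) : Set where
  constructor window
  field at : ∀ i → i <ℕ N → X (c +ℕ i) ≡ s * Y i
open ScaledWindow

module _ {X : ℕ → ℚ} {c : ℕ} {s : ℚ} where

  window-≤ : ∀ {N M Y} → ScaledWindow X c N s Y → M ≤ℕ N → ScaledWindow X c M s Y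
  window-≤ w M≤N = window λ i i<M → at w i (ℕ.<-≤-trans i<M M≤N)

  window-origin : ∀ {N Y} → ScaledWindow X c (suc N) s Y → X c ≡ s * Y 0
  window-origin w = trans (cong X (sym (ℕ.+-identityʳ c))) (at w 0 (s≤s z≤n))

  window-root : ∀ {N} ys → ScaledWindow X c (suc N) s (coord ys) → X c ≡ s
  window-root ys w = trans (window-origin w) (ℚ.*-identityʳ s)

  window-head : ∀ {N} ys₁ zs → ScaledWindow X c (suc N) s (coord (ys₁ ++ zs)) → length ys₁ ≡ N →
    ScaledWindow X c (suc N) s (coord ys₁)
  window-head ys₁ zs w refl = window head
    where
    head : ∀ i → i <ℕ suc (length ys₁) → X (c +ℕ i) ≡ s * coord ys₁ i
    head zero    _         = at w 0 (s≤s z≤n)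
    head (suc i) (s≤s i<N) = trans (at w (suc i) (s≤s i<N)) (cong (s *_) (nth-++ˡ ys₁ zs i<N))

  window-tail : ∀ {N M} ys₁ zs → ScaledWindow X c (suc N +ℕ M) s (coord (ys₁ ++ zs)) → length ys₁ ≡ N →
    ScaledWindow X (c +ℕ suc N) M s (nth zs)
  window-tail ys₁ zs w refl = window λ i i<M → let open ≡-Reasoning in begin
    X ((c +ℕ suc (length ys₁)) +ℕ i)      ≡⟨ cong X (ℕ.+-assoc c _ i) ⟩
    X (c +ℕ (suc (length ys₁) +ℕ i))      ≡⟨ at w _ (ℕ.+-monoʳ-< _ i<M) ⟩
    s * nth (ys₁ ++ zs) (length ys₁ +ℕ i) ≡⟨ cong (s *_) (nth-++ʳ ys₁ zs i refl) ⟩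
    s * nth zs i                          ∎

  window-cone : ∀ {M} x₀ ys → ScaledWindow X c M s (nth (x₀ ∷ map (x₀ *_) ys)) →
    ScaledWindow X c M (s * x₀) (coord ys)
  window-cone x₀ ys w = window λ i i<M →
    trans (at w i i<M) (trans (cong (s *_) (nth-cone x₀ ys i)) (sym (ℚ.*-assoc s x₀ _)))

children-scaled : ∀ T {X c s} ys → ScaledWindow X c (size T) s (coord ys) →
  Every (ChildrenScaled X (coord ys) c s) (labelTree T)
children-scaled T@(node _) ys w =
  Every-map (All.map (λ (_ , p<size) → at w _ p<size)) (labelTree T) (children-in T 0 0 1 ℕ.≤-refl ℕ.≤-refl)

component-DT⇒Poly : ∀ T {X c s} ys → 0ℚ ≤ s → ScaledWindow X c (size T) s (coord ys) →
  Every (DTcond (coord ys)) (labelTree T) → Every (PolyCond X c) (lab T c 0 (suc c))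
component-DT⇒Poly T@(node _) {X} {c} ys 0≤s w dt =
  subst (Every (PolyCond X c)) (sym (lab-component T c))
    (Every-translate c (λ {p} {j} {ks} → DT⇒Poly-node X (coord ys) c _ (window-root ys w) 0≤s {p} {j} {ks})
      (labelTree T) (children-scaled T ys w) dt)

component-Poly⇒DT : ∀ T {X c s} ys → 0ℚ < s → ScaledWindow X c (size T) s (coord ys) →
  Every (PolyCond X c) (lab T c 0 (suc c)) → Every (DTcond (coord ys)) (labelTree T)
component-Poly⇒DT T@(node _) {X} {c} ys 0<s w pc =
  Every-untranslate c (λ {p} {j} {ks} → Poly⇒DT-node X (coord ys) c _ (window-root ys w) 0<s {p} {j} {ks})
    (labelTree T) (children-scaled T ys w) (subst (Every (PolyCond X c)) (lab-component T c) pc)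

IsZeroAt : (ℕ → ℚ) → LTree → Set
IsZeroAt X k = X (posOf k) ≡ 0ℚ

zero-children : ∀ X l → X l ≡ 0ℚ → ∀ {p j ks} → PolyCond X l p j ks → All (IsZeroAt X) ks
zero-children X l Xl≡0 {ks = ks} pc =
  All.map (λ {k} → zero-child k)
    (AllP.map⁻ (proj₂ (Linked-between ℚ.≤-trans 0ℚ (X l) (map (cNonRoot X l) ks) pc)))
  where
  zero-child : ∀ k → 0ℚ ≤ cNonRoot X l k × cNonRoot X l k ≤ X l → IsZeroAt X k
  zero-child (lnode i j _) (0≤v , v≤Xl) = *-cancelˡ-≡-pos (half^-pos j) (begin
    half^ j * X i     ≡⟨ ℚ.*-comm (half^ j) (X i) ⟩
    X i * half^ j     ≡⟨ [p-q]+q≡p (X i * half^ j) (X l) ⟨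
    v + X l           ≡⟨ cong₂ _+_ v≡0 Xl≡0 ⟩
    0ℚ                ≡⟨ ℚ.*-zeroʳ (half^ j) ⟨
    half^ j * 0ℚ      ∎)
    where
    open ≡-Reasoning
    v = X i * half^ j - X l
    v≡0 : v ≡ 0ℚ
    v≡0 = squeeze-0 Xl≡0 0≤v v≤Xl

zero-component : ∀ T c X → Every (PolyCond X c) (lab T c 0 (suc c)) → X c ≡ 0ℚ →
  ∀ i → i <ℕ size T → X (c +ℕ i) ≡ 0ℚ
zero-component T          c X pc root≡0 zero    _        = trans (cong X (ℕ.+-identityʳ c)) root≡0
zero-component T@(node _) c X pc root≡0 (suc i) (s≤s i<) =
  subst (λ n → X n ≡ 0ℚ) (sym (ℕ.+-suc c i))
    (cover-positions {Q = λ n → X n ≡ 0ℚ} T c 0 (suc c)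
      (Every-map (λ {p} {j} {ks} → zero-children X c root≡0 {p} {j} {ks}) (lab T c 0 (suc c)) pc) i i<)

zero-everywhere : ∀ Ts c X → PolyComponents X (labelsF Ts c) → All (IsZeroAt X) (labelsF Ts c) →
  ∀ i → i <ℕ sizes Ts → X (c +ℕ i) ≡ 0ℚ
zero-everywhere (T@(node _) ∷ Ts) c X (pc , pcs) (root≡0 ∷ roots≡0) i i< with <-+-cases (size T) i<
... | inj₁ i<size              = zero-component T c X pc root≡0 i i<size
... | inj₂ (i′ , refl , i′<) =
  subst (λ n → X n ≡ 0ℚ) (ℕ.+-assoc c (size T) i′) (zero-everywhere Ts _ X pcs roots≡0 i′ i′<)

powers : ℕ → ℕ → List ℚ
powers zero    j = []
powers (suc k) j = two^ j ∷ powers k (suc j)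

length-powers : ∀ k j → length (powers k j) ≡ k
length-powers zero    j = refl
length-powers (suc k) j = cong suc (length-powers k (suc j))

nth-powers : ∀ k j {m} → m <ℕ k → nth (powers k j) m ≡ two^ (j +ℕ m)
nth-powers (suc k) j {zero}  _         = cong two^ (sym (ℕ.+-identityʳ j))
nth-powers (suc k) j {suc m} (s≤s m<k) = trans (nth-powers k (suc j) m<k) (cong two^ (sym (ℕ.+-suc j m)))

-- The point of D_T with x_{p(u)} = 2^{j(u)}: every ratio x_{p(u)} / 2^{j(u)} equals 1.
mutual
  canonical : Tree → ℕ → List ℚ
  canonical (node ts) j = powers (length ts) j ++ canonicals ts j

  canonicals : List Tree → ℕ → List ℚ
  canonicals []       j = []
  canonicals (t ∷ ts) j = canonical t (j +ℕ length ts) ++ canonicals ts j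

mutual
  length-canonical : ∀ t j → length (canonical t j) ≡ size t ∸ 1
  length-canonical (node ts) j = begin
    length (powers (length ts) j ++ canonicals ts j)           ≡⟨ List.length-++ (powers (length ts) j) ⟩
    length (powers (length ts) j) +ℕ length (canonicals ts j)
      ≡⟨ cong₂ _+ℕ_ (length-powers _ j) (length-canonicals ts j) ⟩
    length ts +ℕ nonRootCount ts                              ≡⟨ length+nonRootCount ts ⟩
    sizes ts                                                  ∎
    where open ≡-Reasoning

  length-canonicals : ∀ ts j → length (canonicals ts j) ≡ nonRootCount ts
  length-canonicals []       j = refl
  length-canonicals (t ∷ ts) j =
    trans (List.length-++ (canonical t _)) (cong₂ _+ℕ_ (length-canonical t _) (length-canonicals ts j))

all-one-chain : ∀ xs → All (_≡ 1ℚ) xs → Chain (1ℚ ∷ xs ++ [ 1ℚ + 1ℚ ])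
all-one-chain []       []          = ℚ.+-monoʳ-≤ 1ℚ (ℚ.<⇒≤ 0<1) ∷ [-]
all-one-chain (_ ∷ xs) (refl ∷ es) = ℚ.≤-refl ∷ all-one-chain xs es

module _ (x : ℕ → ℚ) where

  Agrees : ℕ → List ℚ → Set
  Agrees c ys = ∀ i → i <ℕ length ys → x (c +ℕ i) ≡ nth ys i

  agrees-++ˡ : ∀ c ys zs → Agrees c (ys ++ zs) → Agrees c ys
  agrees-++ˡ c ys zs agree i i< =
    trans (agree i (ℕ.<-≤-trans i< (List.length-++-≤ˡ ys))) (nth-++ˡ ys zs i<)

  agrees-++ʳ : ∀ c ys zs {n} → Agrees c (ys ++ zs) → length ys ≡ n → Agrees (c +ℕ n) zs
  agrees-++ʳ c ys zs agree refl i i< = begin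
    x ((c +ℕ length ys) +ℕ i)   ≡⟨ cong x (ℕ.+-assoc c _ i) ⟩
    x (c +ℕ (length ys +ℕ i))   ≡⟨ agree _ (subst (length ys +ℕ i <ℕ_) (sym (List.length-++ ys)) (ℕ.+-monoʳ-< _ i<)) ⟩
    nth (ys ++ zs) (length ys +ℕ i) ≡⟨ nth-++ʳ ys zs i refl ⟩
    nth zs i                    ∎
    where open ≡-Reasoning

  mutual
    canonical-DT : ∀ t p j nx → Agrees nx (canonical t j) → Every (DTcond x) (lab t p j nx)
    canonical-DT (node ts) p j nx agree =
      all-one-chain _ (AllP.map⁺ (canonical-siblings ts nx j _ on-powers))
      , canonical-subtrees ts nx j _ (agrees-++ʳ nx (powers (length ts) j) _ agree (length-powers _ j))
      where
      on-powers : ∀ m → m <ℕ length ts → x (nx +ℕ m) ≡ two^ (j +ℕ m)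
      on-powers m m< =
        trans (agrees-++ˡ nx (powers (length ts) j) _ agree m (subst (m <ℕ_) (sym (length-powers _ j)) m<))
              (nth-powers _ j m<)

    canonical-siblings : ∀ ts b j nx → (∀ m → m <ℕ length ts → x (b +ℕ m) ≡ two^ (j +ℕ m)) →
      All (λ k → scaled x k ≡ 1ℚ) (labs ts b j nx)
    canonical-siblings []            b j nx _          = []
    canonical-siblings (node _ ∷ ts) b j nx on-powers =
      trans (cong (_* half^ (j +ℕ length ts)) (on-powers (length ts) (ℕ.n<1+n _)))
            (two^*half^≡1 (j +ℕ length ts))
      ∷ canonical-siblings ts b j _ (λ m m< → on-powers m (ℕ.m<n⇒m<1+n m<))

    canonical-subtrees : ∀ ts b j nx → Agrees nx (canonicals ts j) → EveryL (DTcond x) (labs ts b j nx)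
    canonical-subtrees []       b j nx _     = _
    canonical-subtrees (t ∷ ts) b j nx agree =
      canonical-DT t _ _ nx (agrees-++ˡ nx (canonical t _) _ agree)
      , canonical-subtrees ts b j _ (agrees-++ʳ nx (canonical t _) _ agree (length-canonical t _))

canonical∈DT : ∀ T → InDT T (canonical T 0)
canonical∈DT T = length-canonical T 0 , canonical-DT (coord (canonical T 0)) T 0 0 1 (λ i _ → refl)

DF-nonempty : ∀ T Ts → Σ (List ℚ) λ ys → InDF (T ∷ Ts) ys × length ys ≡ sizes (T ∷ Ts) ∸ 1
DF-nonempty T@(node us) []                  =
  canonical T 0 , canonical∈DT T , trans (length-canonical T 0) (sym (ℕ.+-identityʳ _))
DF-nonempty T@(node us) (T′@(node _) ∷ Ts) with DF-nonempty T′ Ts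
... | ys′ , ys′∈ , len′ =
  canonical T 0 ++ 0ℚ ∷ map (0ℚ *_) ys′
  , (canonical T 0 , 0ℚ ∷ map (0ℚ *_) ys′ , refl , canonical∈DT T
    , ℚ.≤-refl , ℚ.<⇒≤ 0<1 , ys′ , ys′∈ , refl)
  , trans (List.length-++ (canonical T 0))
      (cong₂ _+ℕ_ (length-canonical T 0) (cong suc (trans (List.length-map (0ℚ *_) ys′) len′)))

RootsDescending : (ℕ → ℚ) → List LTree → Set
RootsDescending X rs = Linked _≥_ (map (λ r → X (posOf r)) rs ++ [ 0ℚ ])

PolyFrom : (ℕ → ℚ) → ℕ → Forest → Set
PolyFrom X c Ts = PolyComponents X (labelsF Ts c) × RootsDescending X (labelsF Ts c)

DF⇒Poly : ∀ T Ts c X {s} ys → 0ℚ ≤ s → ScaledWindow X c (sizes (T ∷ Ts)) s (coord ys) →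
  InDF (T ∷ Ts) ys → PolyFrom X c (T ∷ Ts)
DF⇒Poly T@(node _) [] c X ys 0≤s w (_ , dt) =
  (component-DT⇒Poly T ys 0≤s (window-≤ w (ℕ.m≤m+n _ 0)) dt , _)
  , (subst (0ℚ ≤_) (sym (window-root ys w)) 0≤s ∷ [-])
DF⇒Poly T@(node _) (T′@(node _) ∷ Ts) c X {s} ys 0≤s w
        (ys₁ , x₀ ∷ zs , refl , (len₁ , dt) , 0≤x₀ , x₀≤1 , ys′ , ys′∈ , refl) =
  (component-DT⇒Poly T ys₁ 0≤s w₁ dt , proj₁ rest) , (root′≤root ∷ proj₂ rest)
  where
  w₁ : ScaledWindow X c (size T) s (coord ys₁)
  w₁ = window-head ys₁ _ (window-≤ w (ℕ.m≤m+n _ _)) len₁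
  w′ : ScaledWindow X (c +ℕ size T) (sizes (T′ ∷ Ts)) (s * x₀) (coord ys′)
  w′ = window-cone x₀ ys′ (window-tail ys₁ _ w len₁)
  rest = DF⇒Poly T′ Ts _ X ys′ (*-nonNeg 0≤s 0≤x₀) w′ ys′∈
  root′≤root : X (c +ℕ size T) ≤ X c
  root′≤root = subst₂ _≤_ (sym (window-root ys′ w′)) (trans (ℚ.*-identityʳ s) (sym (window-root ys w)))
    (ℚ.*-monoˡ-≤-nonNeg s {{nonNegative 0≤s}} x₀≤1)

degenerate-cone : ∀ T Ts c X {s} zs → 0ℚ < s → ScaledWindow X c (sizes (T ∷ Ts)) s (nth (0ℚ ∷ zs)) →
  length zs ≡ sizes (T ∷ Ts) ∸ 1 → PolyFrom X c (T ∷ Ts) → InCone (InDF (T ∷ Ts)) (0ℚ ∷ zs)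
degenerate-cone T@(node _) Ts c X {s} zs 0<s w len (pcs , rd) with DF-nonempty T Ts
... | ys , ys∈ , len-ys = ℚ.≤-refl , ℚ.<⇒≤ 0<1 , ys , ys∈ , ≡map-0* zs ys (trans len (sym len-ys)) zs≡0
  where
  root≡0 : X c ≡ 0ℚ
  root≡0 = trans (window-origin w) (ℚ.*-zeroʳ s)
  roots≡0 : All (IsZeroAt X) (labelsF (T ∷ Ts) c)
  roots≡0 = root≡0 ∷ All.map (λ (r≤root , 0≤r) → squeeze-0 root≡0 0≤r r≤root)
    (AllP.map⁻ (proj₂ (Linked-between ≥-trans (X c) 0ℚ _ rd)))
  zs≡0 : ∀ i → i <ℕ length zs → nth zs i ≡ 0ℚ
  zs≡0 i i< = *-cancelˡ-≡-pos 0<s (begin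
    s * nth zs i   ≡⟨ at w (suc i) i+1< ⟨
    X (c +ℕ suc i) ≡⟨ zero-everywhere (T ∷ Ts) c X pcs roots≡0 (suc i) i+1< ⟩
    0ℚ             ≡⟨ ℚ.*-zeroʳ s ⟨
    s * 0ℚ         ∎)
    where
    open ≡-Reasoning
    i+1< : suc i <ℕ sizes (T ∷ Ts)
    i+1< = s≤s (subst (i <ℕ_) len i<)

Poly⇒DF : ∀ T Ts c X {s} ys → 0ℚ < s → ScaledWindow X c (sizes (T ∷ Ts)) s (coord ys) →
  length ys ≡ sizes (T ∷ Ts) ∸ 1 → PolyFrom X c (T ∷ Ts) → InDF (T ∷ Ts) ys
Poly⇒DF T@(node _) [] c X ys 0<s w len ((pc , _) , _) =
  trans len (ℕ.+-identityʳ _) , component-Poly⇒DT T ys 0<s (window-≤ w (ℕ.m≤m+n _ 0)) pc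
Poly⇒DF T@(node us) (T′@(node _) ∷ Ts) c X {s} ys 0<s w len ((pc , pcs) , root′≤root ∷ rd′)
  with split-at ys (sizes us) _ len
... | ys₁ , x₀ , zs , refl , len₁ , len₂ =
  ys₁ , x₀ ∷ zs , refl , (len₁ , component-Poly⇒DT T ys₁ 0<s w₁ pc) , cone (ℚ.<-cmp 0ℚ x₀)
  where
  w₁ : ScaledWindow X c (size T) s (coord ys₁)
  w₁ = window-head ys₁ _ (window-≤ w (ℕ.m≤m+n _ _)) len₁
  w₂ : ScaledWindow X (c +ℕ size T) (sizes (T′ ∷ Ts)) s (nth (x₀ ∷ zs))
  w₂ = window-tail ys₁ _ w len₁
  cancel : ∀ {a b} → s * a ≤ s * b → a ≤ b
  cancel = ℚ.*-cancelˡ-≤-pos s {{positive 0<s}}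
  0≤x₀ : 0ℚ ≤ x₀
  0≤x₀ = cancel (subst₂ _≤_ (sym (ℚ.*-zeroʳ s)) (window-origin w₂)
    (proj₁ (Linked-between ≥-trans _ 0ℚ _ rd′)))
  x₀≤1 : x₀ ≤ 1ℚ
  x₀≤1 = cancel
    (subst₂ _≤_ (window-origin w₂) (trans (window-root ys w) (sym (ℚ.*-identityʳ s))) root′≤root)
  cone : Tri (0ℚ < x₀) (0ℚ ≡ x₀) (x₀ < 0ℚ) → InCone (InDF (T′ ∷ Ts)) (x₀ ∷ zs)
  cone (tri< 0<x₀ _ _) = 0≤x₀ , x₀≤1 , ys′ , Poly⇒DF T′ Ts _ X ys′ (*-pos 0<s 0<x₀) w′ len′ (pcs , rd′) , zs≡
    where
    instance _ = ℚ.pos⇒nonZero x₀ {{positive 0<x₀}}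
    ys′ = map (1/ x₀ *_) zs
    zs≡ : zs ≡ map (x₀ *_) ys′
    zs≡ = ≡map-*-1/ x₀ zs
    w′ : ScaledWindow X (c +ℕ size T) (sizes (T′ ∷ Ts)) (s * x₀) (coord ys′)
    w′ = window-cone x₀ ys′ (subst (λ zs → ScaledWindow X _ _ s (nth (x₀ ∷ zs))) zs≡ w₂)
    len′ : length ys′ ≡ sizes (T′ ∷ Ts) ∸ 1
    len′ = trans (List.length-map _ zs) len₂
  cone (tri≈ _ refl _) = degenerate-cone T′ Ts _ X zs 0<s w₂ len₂ (pcs , rd′)
  cone (tri> _ _ x₀<0) = contradiction (ℚ.≤-<-trans 0≤x₀ x₀<0) (ℚ.<-irrefl refl)

ascending-reverse⇔descending : ∀ xs → Chain (0ℚ ∷ reverse xs) ⇔ Linked _≥_ (xs ++ [ 0ℚ ])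
ascending-reverse⇔descending xs = mk⇔
  (λ asc → reverse⁻ (xs ++ [ 0ℚ ]) (subst Chain (sym (List.reverse-++ xs [ 0ℚ ])) asc))
  (λ desc → subst Chain (List.reverse-++ xs [ 0ℚ ]) (reverse⁺ desc))

proposition5p2 : (n : ℕ) (F : Forest) → forestSize F ≡ suc n →
    (x : Vec ℚ n) → InPoly F (toList x) ⇔ InDF F (toList x)
proposition5p2 n []       ()
proposition5p2 n (T ∷ Ts) size≡ x = mk⇔
  (λ (pc , ascending , _) → Poly⇒DF T Ts 0 X xs 0<1 unscaled length≡ (pc , Equivalence.to roots⇔ ascending))
  (λ d → let (pc , descending) = DF⇒Poly T Ts 0 X xs (ℚ.<⇒≤ 0<1) unscaled d
         in pc , Equivalence.from roots⇔ descending , refl)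
  where
  xs = toList x
  X = coord xs
  roots⇔ = ascending-reverse⇔descending (map (λ r → X (posOf r)) (labelForest (T ∷ Ts)))
  unscaled : ScaledWindow X 0 (sizes (T ∷ Ts)) 1ℚ X
  unscaled = window λ i _ → sym (ℚ.*-identityˡ (X i))
  length≡ : length xs ≡ sizes (T ∷ Ts) ∸ 1
  length≡ = trans (Vec.length-toList x) (cong (_∸ 1) (sym size≡))
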